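{- For all $P$ and $\pi$ as described in the context: \begin{enumerate} \item every two disjoint edges of $H_k(P,\pi)$ form a pattern belonging to the cube $\mathcal{C}(P,\pi)$; \item $H_k(P,\pi)$ is isomorphic to $H_k((AB)^r,\pi')$, where $\pi'$ is the partition of $[r]$ into consecutive blocks of sizes $r_i$, $i=0,\dots,t$. \end{enumerate}
   Context: An ordered $r$-matching is a set of pairwise disjoint $r$-element subsets (edges) of a linearly ordered vertex set; an $r$-pattern is an ordered $r$-matching with two edges, written as a word in letters $A,B$ each appearing $r$ times (two edges form a pattern if they are order-isomorphic to it). For a pattern $Q$, a $Q$-clique is a matching in which every pair of edges forms $Q$; for a set $\mathcal{P}$ of patterns, a $\mathcal{P}$-clique is a matching in which every pair of edges forms a pattern from $\mathcal{P}$. An $r$-pattern $P$ is collectable if it splits (uniquely) into consecutive blocks $P=S_1\cdots S_s$ with each $S_i$ of the form $A^{\lambda_i}B^{\lambda_i}$ or $B^{\lambda_i}A^{\lambda_i}$, so $|S_i|=2\lambda_i$ and $r=\lambda_1+\cdots+\lambda_s$. Let $P$ be a collectable $r$-pattern with this splitting, and let $\pi$ be a partition $[s]=T_0\cup T_1\cup\cdots\cup T_t$ with $1\in T_0$ and all $T_j\neq\emptyset$. For $j=0,\dots,t$, set $r_j:=\sum_{i\in T_j}\lambda_i$ and let the mega-block $P_j$ be the $r_j$-pattern formed by concatenating the segments $S_i$ with $i\in T_j$ (if $r_j=1$, this is the degenerate 1-pattern $AB$). For $F\subseteq[t]$, $P_F$ is obtained from $P$ by flipping (exchanging $A$ and $B$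 in) every mega-block $P_j$ with $j\in F$; the $t$-cube is $\mathcal{C}(P,\pi)=\{P_F: F\subseteq[t]\}$. For $k\ge2$, the hypergraph $H_k(P,\pi)$ is defined as follows. Let $V$ be a linearly ordered set of $kr$ vertices split into consecutive blocks $V_1,\dots,V_s$ with $|V_i|=k\lambda_i$. For $j=0,\dots,t$, let $U_j=\bigcup_{i\in T_j}V_i$ and let $K_j$ be the unique $P_j$-clique of size $k$ on $U_j$ (for $r_j=1$, $K_j$ is a 1-matching of $k$ singletons). Then $H_k(P,\pi)=K_0\times K_1\times\cdots\times K_t$, the $r$-uniform hypergraph on $V$ whose edges are all sets $e^{(0)}\cup e^{(1)}\cup\cdots\cup e^{(t)}$ with $e^{(j)}\in K_j$ for each $j$. The hypergraph is regarded as ordered or unordered depending on context; $(AB)^r$ denotes the $r$-partite pattern $ABAB\cdots AB$. -}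

module Defs where

open import Data.Nat using (ℕ; zero; suc; _+_; _*_; _≤_; _<_; _<ᵇ_)
open import Data.Bool using (Bool; true; false; if_then_else_; not; _xor_)
open import Data.Fin using (Fin; zero; suc; toℕ)
import Data.Fin as Fin
open import Data.Fin.Subset using (Subset; _∈_; _⊆_; ∣_∣; ⋃)
open import Data.List using (List; []; _∷_; _++_; replicate)
import Data.List as List
open import Data.Vec using (tabulate; lookup)
import Data.Vec as Vec
open import Data.Product using (Σ; _×_; _,_; ∃)
open import Data.Sum using (_⊎_)
open import Data.Empty using (⊥)
open import Relation.Nullary using (does; ¬_)
open import Relation.Binary.PropositionalEquality using (_≡_)
open import Function.Bundles using (_↔_; Inverse; _⇔_)

data Letter : Set where
  A B : Letter

flipL : Letter → Letter
flipL A = B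
flipL B = A

sumF : ∀ {n} → (Fin n → ℕ) → ℕ
sumF {zero}  f = 0
sumF {suc n} f = f zero + sumF (λ i → f (suc i))

concatF : ∀ {n} {X : Set} → (Fin n → List X) → List X
concatF {zero}  f = []
concatF {suc n} f = f zero ++ concatF (λ i → f (suc i))

preSum : ∀ {n} → (Fin n → ℕ) → Fin n → ℕ
preSum f i = sumF (λ i' → if toℕ i' <ᵇ toℕ i then f i' else 0)

-- Two edges (subsets of a linearly ordered vertex set Fin n) and the
-- word they form: reading vertices in increasing order, write A for a
-- vertex of the first edge and B for a vertex of the second.

pairWord : ∀ {n} → Subset n → Subset n → List Letter
pairWord Vec.[] Vec.[] = []
pairWord (x Vec.∷ e) (y Vec.∷ f) =
  if x then A ∷ pairWord e f else (if y then B ∷ pairWord e f else pairWord e f)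

Disjoint : ∀ {n} → Subset n → Subset n → Set
Disjoint e f = ∀ v → v ∈ e → v ∈ f → ⊥

-- two edges form the pattern Q iff they are order-isomorphic to it
-- (an unlabelled pair of edges, so either edge may play the role of A)
Forms : ∀ {n} → Subset n → Subset n → List Letter → Set
Forms e f Q = (pairWord e f ≡ Q) ⊎ (pairWord f e ≡ Q)

-- A collectable pattern given by its (unique) splitting into segments
-- S_i = A^{λ_i} B^{λ_i} (ori i = true) or B^{λ_i} A^{λ_i} (ori i = false),
-- together with a partition π of [s] into classes T_0,...,T_t given by
-- the class map cls : Fin s → Fin (suc t)  (i ∈ T_j  iff  cls i ≡ j).

record Shape : Set where
  field
    s   : ℕ
    len : Fin s → ℕ
    ori : Fin s → Bool
    t   : ℕ
    cls : Fin s → Fin (suc t)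
open Shape public

WellFormed : Shape → Set
WellFormed D =
  (∀ i → 1 ≤ len D i) ×
  (Σ (Fin (s D)) (λ i → (toℕ i ≡ 0) × (cls D i ≡ zero))) ×
  (∀ j → Σ (Fin (s D)) (λ i → cls D i ≡ j))

segWord : ℕ → Bool → List Letter
segWord l true  = replicate l A ++ replicate l B
segWord l false = replicate l B ++ replicate l A

rOf : Shape → ℕ
rOf D = sumF (len D)

patternOf : Shape → List Letter
patternOf D = concatF (λ i → segWord (len D i) (ori D i))

isIn : ∀ {t} → Fin (suc t) → Fin (suc t) → Bool
isIn i j = does (i Fin.≟ j)

rj : (D : Shape) → Fin (suc (t D)) → ℕ
rj D j = sumF (λ i → if isIn (cls D i) j then len D i else 0)

megaWord : (D : Shape) → Fin (suc (t D)) → List Letter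
megaWord D j = concatF (λ i → if isIn (cls D i) j then segWord (len D i) (ori D i) else [])

extF : ∀ {t} → (Fin t → Bool) → Fin (suc t) → Bool
extF F zero    = false
extF F (suc j) = F j

cubeWord : (D : Shape) → (Fin (t D) → Bool) → List Letter
cubeWord D F = concatF (λ i → segWord (len D i) (ori D i xor extF F (cls D i)))

InCube : (D : Shape) → List Letter → Set
InCube D Q = Σ (Fin (t D) → Bool) (λ F → cubeWord D F ≡ Q)

nV : Shape → ℕ → ℕ
nV D k = k * rOf D

InBlock : (D : Shape) (k : ℕ) → Fin (s D) → Fin (nV D k) → Set
InBlock D k i v = (k * preSum (len D) i ≤ toℕ v) × (toℕ v < k * (preSum (len D) i + len D i))

InU : (D : Shape) (k : ℕ) → Fin (suc (t D)) → Fin (nV D k) → Set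
InU D k j v = Σ (Fin (s D)) (λ i → (cls D i ≡ j) × InBlock D k i v)

IsCliqueOn : ∀ {n} (k : ℕ) → (Fin n → Set) → ℕ → List Letter → (Fin k → Subset n) → Set
IsCliqueOn {n} k U m Q K =
  (∀ a → ∣ K a ∣ ≡ m) ×
  (∀ a (v : Fin n) → v ∈ K a → U v) ×
  (∀ a b → ¬ (a ≡ b) → Disjoint (K a) (K b)) ×
  (∀ a b → ¬ (a ≡ b) → Forms (K a) (K b) Q)

-- the family (K_0, ..., K_t): K_j is a P_j-clique of size k on U_j
-- (these are unique; we allow any family satisfying the definition)
ValidCliques : (D : Shape) (k : ℕ) → (Fin (suc (t D)) → Fin k → Subset (nV D k)) → Set
ValidCliques D k K = ∀ j → IsCliqueOn k (InU D k j) (rj D j) (megaWord D j) (K j)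

HEdge : (D : Shape) (k : ℕ) → (Fin (suc (t D)) → Fin k → Subset (nV D k)) → Subset (nV D k) → Set
HEdge D k K e = Σ (Fin (suc (t D)) → Fin k) (λ a → e ≡ ⋃ (List.map (λ j → K j (a j)) (List.allFin (suc (t D)))))

ABShape : (D : Shape) → (Fin (rOf D) → Fin (suc (t D))) → Shape
ABShape D cls' = record { s = rOf D ; len = λ _ → 1 ; ori = λ _ → true ; t = t D ; cls = cls' }

ConsecutiveBlocks : (D : Shape) → (Fin (rOf D) → Fin (suc (t D))) → Set
ConsecutiveBlocks D cls' =
  ∀ p → (preSum (rj D) (cls' p) ≤ toℕ p) × (toℕ p < preSum (rj D) (cls' p) + rj D (cls' p))

imageSub : ∀ {n m} → Fin n ↔ Fin m → Subset n → Subset m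
imageSub φ e = tabulate (λ w → lookup e (Inverse.from φ w))

Isomorphic : ∀ {n m} → (Subset n → Set) → (Subset m → Set) → Set
Isomorphic {n} {m} H H' = Σ (Fin n ↔ Fin m) (λ φ → ∀ e → H e ⇔ H' (imageSub φ e))

module Submission where

-- Label the vertices of U_j by the edge of K_j containing them. For every two labels
-- the resulting word over Fin k has the pattern P_j up to flipping; counting and
-- pigeonhole inside each block V_i show that every label occurs exactly λ_i times
-- there, so this pattern splits block by block into the segments S_i. Two disjoint
-- edges of K_0 × ⋯ × K_t use distinct edges of every K_j, and on V_i they only meet
-- K_{cls i}; hence they form S_i, flipped according to K_{cls i} alone, which is a
-- word of the cube. For the isomorphism, every vertex lies on exactly one edge (j, c)
-- of one K_j, and both hypergraphs have r_j vertices with label (j, c); any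
-- label-preserving bijection therefore maps edges to edges.

open import Defs
open import Data.Bool using (Bool; true; false; if_then_else_; not; _xor_; _∨_)
open import Data.Bool.Properties using (xor-identityʳ; not-distribʳ-xor; not-¬)
open import Data.Empty using (⊥; ⊥-elim)
open import Data.Fin using (Fin; zero; suc; toℕ; punchIn)
open import Data.Fin.Permutation using (Permutation; _⟨$⟩ʳ_; insert; insert-punchIn)
import Data.Fin.Permutation as Perm
open import Data.Fin.Subset using (Subset; _∈_; _∪_; ⋃; ∣_∣)
import Data.Fin.Subset as Sub
import Data.Fin as Fin
import Data.Fin.Properties as Finₚ
import Data.List as List
open import Data.List using (List; []; _∷_; _++_; replicate; length; map; mapMaybe; catMaybes; allFin)
open import Data.List.Properties
  using (length-++; map-++; map-replicate; length-replicate; map-cong; map-∘; ∷-injective; map-tabulate;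
         mapMaybe-++; mapMaybe-cong; mapMaybe-nothing; length-mapMaybe; map-mapMaybe; mapMaybe-map)
open import Data.Maybe using (Maybe; just; nothing; _>>=_)
import Data.Maybe as Maybe
open import Data.Nat
open import Data.Nat.Properties
open import Algebra.Properties.CommutativeSemigroup +-commutativeSemigroup using (interchange; x∙yz≈y∙xz)
open import Data.Nat.ListAction using (sum)
open import Data.Nat.ListAction.Properties using (sum-++)
open import Data.Product using (Σ; _×_; _,_; proj₁; proj₂)
import Data.Product.Properties as Productₚ
open import Data.Sum using (_⊎_; inj₁; inj₂)
open import Data.Vec using ([]; _∷_; lookup; here; there; tabulate)
import Data.Vec.Properties as Vecₚ
open import Function using (_∘_)
open import Function.Bundles using (Inverse; mk⇔)
open import Relation.Nullary using (does; ¬_; yes; no; Dec)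
open import Relation.Nullary.Decidable using (_×-dec_; dec-true; dec-false)
open import Relation.Binary.Definitions using (DecidableEquality; tri<; tri≈; tri>)
open import Relation.Binary.PropositionalEquality

sumF-cong : ∀ {n} {f g : Fin n → ℕ} → (∀ i → f i ≡ g i) → sumF f ≡ sumF g
sumF-cong {zero}  f≗g = refl
sumF-cong {suc n} f≗g = cong₂ _+_ (f≗g zero) (sumF-cong (f≗g ∘ suc))

sumF-mono : ∀ {n} {f g : Fin n → ℕ} → (∀ i → f i ≤ g i) → sumF f ≤ sumF g
sumF-mono {zero}  f≤g = z≤n
sumF-mono {suc n} f≤g = +-mono-≤ (f≤g zero) (sumF-mono (f≤g ∘ suc))

sumF-const : ∀ n m → sumF {n} (λ _ → m) ≡ n * m
sumF-const zero    m = refl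
sumF-const (suc n) m = cong (m +_) (sumF-const n m)

sumF-zero : ∀ {n} (f : Fin n → ℕ) → (∀ i → f i ≡ 0) → sumF f ≡ 0
sumF-zero {n} f f≗0 = trans (sumF-cong f≗0) (trans (sumF-const n 0) (*-zeroʳ n))

sumF-+ : ∀ {n} (f g : Fin n → ℕ) → sumF (λ i → f i + g i) ≡ sumF f + sumF g
sumF-+ {zero}  f g = refl
sumF-+ {suc n} f g = trans (cong (f zero + g zero +_) (sumF-+ (f ∘ suc) (g ∘ suc)))
                           (interchange (f zero) (g zero) _ _)

sumF-* : ∀ {n} k (f : Fin n → ℕ) → sumF (λ i → k * f i) ≡ k * sumF f
sumF-* {zero}  k f = sym (*-zeroʳ k)
sumF-* {suc n} k f = trans (cong (k * f zero +_) (sumF-* k (f ∘ suc))) (sym (*-distribˡ-+ k (f zero) _))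

sumF-indicatorˡ : ∀ {n} (j : Fin n) m → sumF (λ i → if does (i Fin.≟ j) then m else 0) ≡ m
sumF-indicatorˡ {suc n} zero    m = trans (cong (m +_) (sumF-zero {n} _ λ _ → refl)) (+-identityʳ m)
sumF-indicatorˡ {suc n} (suc j) m = sumF-indicatorˡ j m

sumF-indicatorʳ : ∀ {n} (j : Fin n) m → sumF (λ i → if does (j Fin.≟ i) then m else 0) ≡ m
sumF-indicatorʳ {suc n} zero    m = trans (cong (m +_) (sumF-zero {n} _ λ _ → refl)) (+-identityʳ m)
sumF-indicatorʳ {suc n} (suc j) m = sumF-indicatorʳ j m

sumF-swap : ∀ {n m} (f : Fin n → Fin m → ℕ) →
            sumF (λ i → sumF (f i)) ≡ sumF (λ j → sumF (λ i → f i j))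
sumF-swap {zero}  {m} f = sym (sumF-zero {m} _ λ _ → refl)
sumF-swap {suc n} {m} f = trans (cong (sumF (f zero) +_) (sumF-swap (f ∘ suc)))
                                (sym (sumF-+ (f zero) (λ j → sumF (λ i → f (suc i) j))))

term≤sumF : ∀ {n} (f : Fin n → ℕ) i → f i ≤ sumF f
term≤sumF f zero    = m≤m+n _ _
term≤sumF f (suc i) = ≤-trans (term≤sumF (f ∘ suc) i) (m≤n+m _ _)

sumF-≤-≡⇒≡ : ∀ {n} (f g : Fin n → ℕ) → (∀ i → f i ≤ g i) → sumF f ≡ sumF g → ∀ i → f i ≡ g i
sumF-≤-≡⇒≡ {suc n} f g f≤g Σf≡Σg = λ where
    zero    → head≡
    (suc i) → sumF-≤-≡⇒≡ (f ∘ suc) (g ∘ suc) (f≤g ∘ suc) tail≡ i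
  where
  head≡ : f zero ≡ g zero
  head≡ = ≤-antisym (f≤g zero) (+-cancelʳ-≤ (sumF (f ∘ suc)) (g zero) (f zero)
            (≤-trans (+-monoʳ-≤ (g zero) (sumF-mono (f≤g ∘ suc))) (≤-reflexive (sym Σf≡Σg))))
  tail≡ : sumF (f ∘ suc) ≡ sumF (g ∘ suc)
  tail≡ = +-cancelˡ-≡ (f zero) _ _ (trans Σf≡Σg (cong (_+ sumF (g ∘ suc)) (sym head≡)))

sumF-punchIn : ∀ {m} (g : Fin (suc m) → ℕ) w → sumF g ≡ g w + sumF (g ∘ punchIn w)
sumF-punchIn         g zero    = refl
sumF-punchIn {suc m} g (suc w) = begin
  g zero + sumF (g ∘ suc)                              ≡⟨ cong (g zero +_) (sumF-punchIn (g ∘ suc) w) ⟩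
  g zero + (g (suc w) + sumF (g ∘ suc ∘ punchIn w))    ≡⟨ x∙yz≈y∙xz (g zero) (g (suc w)) _ ⟩
  g (suc w) + (g zero + sumF (g ∘ suc ∘ punchIn w))    ∎
  where open ≡-Reasoning

pigeonhole : ∀ {k} (x : Fin k → ℕ) m → sumF x ≤ k * m → ∀ a → m < x a → Σ (Fin k) λ b → b ≢ a × x b < m
pigeonhole {k} x m Σx≤km a m<xa with Finₚ.¬∀⟶∃¬ k (λ b → b ≢ a → m ≤ x b) dec ¬allLarge
  where
  dec : ∀ b → Dec (b ≢ a → m ≤ x b)
  dec b with b Fin.≟ a | m ≤? x b
  ... | _      | yes m≤xb = yes λ _ → m≤xb
  ... | yes b≡a | no _    = yes λ b≢a → ⊥-elim (b≢a b≡a)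
  ... | no b≢a  | no m≰xb = no λ large → m≰xb (large b≢a)
  ¬allLarge : ¬ (∀ b → b ≢ a → m ≤ x b)
  ¬allLarge large = <⇒≱ (n<1+n (k * m)) (begin
      suc (k * m)                                             ≡⟨ +-comm 1 (k * m) ⟩
      k * m + 1                                               ≡⟨ sym (cong₂ _+_ (sumF-const k m) (sumF-indicatorˡ a 1)) ⟩
      sumF {k} (λ _ → m) + sumF (λ b → if does (b Fin.≟ a) then 1 else 0) ≡⟨ sym (sumF-+ {k} (λ _ → m) _) ⟩
      sumF (λ b → m + (if does (b Fin.≟ a) then 1 else 0))    ≤⟨ sumF-mono bound ⟩
      sumF x                                                  ≤⟨ Σx≤km ⟩
      k * m                                                   ∎)
    where
    open ≤-Reasoning
    bound : ∀ b → m + (if does (b Fin.≟ a) then 1 else 0) ≤ x b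
    bound b with b Fin.≟ a
    ... | yes refl = ≤-trans (≤-reflexive (+-comm m 1)) m<xa
    ... | no b≢a   = ≤-trans (≤-reflexive (+-identityʳ m)) (large b b≢a)
... | b , ¬large = b , (λ b≡a → ¬large λ b≢a → ⊥-elim (b≢a b≡a)) , ≰⇒> (λ m≤xb → ¬large λ _ → m≤xb)

interval : ℕ → ℕ → List ℕ
interval a zero    = []
interval a (suc c) = a ∷ interval (suc a) c

length-interval : ∀ a c → length (interval a c) ≡ c
length-interval a zero    = refl
length-interval a (suc c) = cong suc (length-interval (suc a) c)

interval-suc : ∀ a c → interval (suc a) c ≡ map suc (interval a c)
interval-suc a zero    = refl
interval-suc a (suc c) = cong (suc a ∷_) (interval-suc (suc a) c)

mapMaybe-interval-suc : ∀ {Y : Set} (g : ℕ → Maybe Y) a c → mapMaybe g (interval (suc a) c) ≡ mapMaybe (g ∘ suc) (interval a c)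
mapMaybe-interval-suc g a c = trans (cong (mapMaybe g) (interval-suc a c)) (mapMaybe-map g suc (interval a c))

interval-+ : ∀ a c d → interval a (c + d) ≡ interval a c ++ interval (a + c) d
interval-+ a zero    d = cong (λ b → interval b d) (sym (+-identityʳ a))
interval-+ a (suc c) d = cong (a ∷_) (trans (interval-+ (suc a) c d) (cong (λ b → interval (suc a) c ++ interval b d) (sym (+-suc a c))))

map-cong-interval : ∀ {Y : Set} {f g : ℕ → Y} a c → (∀ p → a ≤ p → p < a + c → f p ≡ g p) →
                    map f (interval a c) ≡ map g (interval a c)
map-cong-interval a zero    f≗g = refl
map-cong-interval a (suc c) f≗g =
  cong₂ _∷_ (f≗g a ≤-refl (m<m+n a z<s))
            (map-cong-interval (suc a) c λ p a<p p<a+1+c → f≗g p (<⇒≤ a<p) (≤-trans p<a+1+c (≤-reflexive (sym (+-suc a c)))))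

mapMaybe-interval-total : ∀ {Y : Set} (g : ℕ → Maybe Y) a c → length (mapMaybe g (interval a c)) ≡ c →
                          ∀ p → a ≤ p → p < a + c → Σ Y λ y → g p ≡ just y
mapMaybe-interval-total g a zero    _ p a≤p p<a+0 = ⊥-elim (<⇒≱ p<a+0 (≤-trans (≤-reflexive (+-identityʳ a)) a≤p))
mapMaybe-interval-total g a (suc c) len p a≤p p<a+1+c with g a in ga≡
... | nothing = ⊥-elim (<-irrefl refl (≤-trans (≤-reflexive (sym len))
                  (≤-trans (length-mapMaybe g (interval (suc a) c)) (≤-reflexive (length-interval (suc a) c)))))
... | just y with p ≟ a
...   | yes refl = y , ga≡
...   | no p≢a = mapMaybe-interval-total g (suc a) c (suc-injective len) p (≤∧≢⇒< a≤p (p≢a ∘ sym))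
                   (≤-trans p<a+1+c (≤-reflexive (+-suc a c)))

mapMaybe-mapMaybe : ∀ {X Y Z : Set} (g : X → Maybe Y) (h : Y → Maybe Z) xs →
                    mapMaybe h (mapMaybe g xs) ≡ mapMaybe (λ x → g x >>= h) xs
mapMaybe-mapMaybe g h [] = refl
mapMaybe-mapMaybe g h (x ∷ xs) with g x
... | nothing = mapMaybe-mapMaybe g h xs
... | just y with h y
...   | nothing = mapMaybe-mapMaybe g h xs
...   | just z  = cong (z ∷_) (mapMaybe-mapMaybe g h xs)

concatF-cong : ∀ {n} {X : Set} {f g : Fin n → List X} → (∀ i → f i ≡ g i) → concatF f ≡ concatF g
concatF-cong {zero}  f≗g = refl
concatF-cong {suc n} f≗g = cong₂ _++_ (f≗g zero) (concatF-cong (f≗g ∘ suc))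

length-concatF : ∀ {n} {X : Set} (f : Fin n → List X) → length (concatF f) ≡ sumF (length ∘ f)
length-concatF {zero}  f = refl
length-concatF {suc n} f = trans (length-++ (f zero)) (cong (length (f zero) +_) (length-concatF (f ∘ suc)))

map-concatF : ∀ {n} {X Y : Set} (h : X → Y) (f : Fin n → List X) → map h (concatF f) ≡ concatF (map h ∘ f)
map-concatF {zero}  h f = refl
map-concatF {suc n} h f = trans (map-++ h (f zero) _) (cong (map h (f zero) ++_) (map-concatF h (f ∘ suc)))

mapMaybe-concatF : ∀ {n} {X Y : Set} (g : X → Maybe Y) (f : Fin n → List X) →
                   mapMaybe g (concatF f) ≡ concatF (mapMaybe g ∘ f)
mapMaybe-concatF {zero}  g f = refl
mapMaybe-concatF {suc n} g f = trans (mapMaybe-++ g (f zero) _) (cong (mapMaybe g (f zero) ++_) (mapMaybe-concatF g (f ∘ suc)))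

++-cancel-length : ∀ {X : Set} (xs ys xs′ ys′ : List X) → xs ++ ys ≡ xs′ ++ ys′ → length xs ≡ length xs′ →
                   xs ≡ xs′ × ys ≡ ys′
++-cancel-length []       ys []         ys′ eq _   = refl , eq
++-cancel-length (x ∷ xs) ys (x′ ∷ xs′) ys′ eq len with ∷-injective eq
... | refl , eq′ with ++-cancel-length xs ys xs′ ys′ eq′ (suc-injective len)
...   | refl , ys≡ys′ = refl , ys≡ys′

concatF-injective : ∀ {n} {X : Set} (f g : Fin n → List X) → concatF f ≡ concatF g →
                    (∀ i → length (f i) ≡ length (g i)) → ∀ i → f i ≡ g i
concatF-injective {suc n} f g eq len i with ++-cancel-length (f zero) _ (g zero) _ eq (len zero)
concatF-injective {suc n} f g eq len zero    | head≡ , _ = head≡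
concatF-injective {suc n} f g eq len (suc i) | _ , tail≡ = concatF-injective (f ∘ suc) (g ∘ suc) tail≡ (len ∘ suc) i

prefix-comparable : ∀ {X : Set} (p s u R : List X) → p ++ s ≡ u ++ R →
                    Σ (List X) (λ s′ → p ++ s′ ≡ u) ⊎ Σ (List X) (λ p′ → p ≡ u ++ p′)
prefix-comparable []      s u       R eq = inj₁ (u , refl)
prefix-comparable (x ∷ p) s []      R eq = inj₂ (x ∷ p , refl)
prefix-comparable (x ∷ p) s (y ∷ u) R eq with ∷-injective eq
... | refl , eq′ with prefix-comparable p s u R eq′
...   | inj₁ (s′ , p++s′≡u) = inj₁ (s′ , cong (x ∷_) p++s′≡u)
...   | inj₂ (p′ , p≡u++p′) = inj₂ (p′ , cong (x ∷_) p≡u++p′)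

𝟙 : Bool → ℕ
𝟙 b = if b then 1 else 0

countᵇ : ∀ {X : Set} → (X → Bool) → List X → ℕ
countᵇ P xs = sum (map (𝟙 ∘ P) xs)

countᵇ-++ : ∀ {X : Set} (P : X → Bool) xs ys → countᵇ P (xs ++ ys) ≡ countᵇ P xs + countᵇ P ys
countᵇ-++ P xs ys = trans (cong sum (map-++ (𝟙 ∘ P) xs ys)) (sum-++ (map (𝟙 ∘ P) xs) _)

countᵇ-map : ∀ {X Y : Set} (P : Y → Bool) (f : X → Y) xs → countᵇ P (map f xs) ≡ countᵇ (P ∘ f) xs
countᵇ-map P f xs = cong sum (sym (map-∘ xs))

countᵇ-interval-suc : ∀ (P : ℕ → Bool) a c → countᵇ P (interval (suc a) c) ≡ countᵇ (P ∘ suc) (interval a c)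
countᵇ-interval-suc P a c = trans (cong (countᵇ P) (interval-suc a c)) (countᵇ-map P suc (interval a c))

countᵇ-positive : ∀ {X : Set} (P : X → Bool) xs → 0 < countᵇ P xs → Σ X λ x → P x ≡ true
countᵇ-positive P (x ∷ xs) pos with P x in Px≡
... | true  = x , Px≡
... | false = countᵇ-positive P xs pos

occurrences : ∀ {k} → Fin k → List (Fin k) → ℕ
occurrences c = countᵇ (λ x → does (x Fin.≟ c))

sumF-occurrences : ∀ {k} (w : List (Fin k)) → sumF (λ c → occurrences c w) ≡ length w
sumF-occurrences {k} []      = sumF-zero {k} _ λ _ → refl
sumF-occurrences {k} (x ∷ w) = trans (sumF-+ (λ c → 𝟙 (does (x Fin.≟ c))) (λ c → occurrences c w))
                                     (cong₂ _+_ (sumF-indicatorʳ x 1) (sumF-occurrences w))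

isLetter : Letter → Letter → Bool
isLetter A A = true
isLetter B B = true
isLetter A B = false
isLetter B A = false

letterCount : Letter → List Letter → ℕ
letterCount Z = countᵇ (λ x → isLetter x Z)

letterCount-replicate : ∀ Z X l → letterCount Z (replicate l X) ≡ (if isLetter X Z then l else 0)
letterCount-replicate A A zero    = refl
letterCount-replicate A B zero    = refl
letterCount-replicate B A zero    = refl
letterCount-replicate B B zero    = refl
letterCount-replicate A A (suc l) = cong suc (letterCount-replicate A A l)
letterCount-replicate A B (suc l) = letterCount-replicate A B l
letterCount-replicate B A (suc l) = letterCount-replicate B A l
letterCount-replicate B B (suc l) = cong suc (letterCount-replicate B B l)

letterCount-segWord : ∀ Z l o → letterCount Z (segWord l o) ≡ l
letterCount-segWord A l true  = trans (countᵇ-++ _ (replicate l A) _)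
  (trans (cong₂ _+_ (letterCount-replicate A A l) (letterCount-replicate A B l)) (+-identityʳ l))
letterCount-segWord B l true  = trans (countᵇ-++ _ (replicate l A) _)
  (cong₂ _+_ (letterCount-replicate B A l) (letterCount-replicate B B l))
letterCount-segWord A l false = trans (countᵇ-++ _ (replicate l B) _)
  (cong₂ _+_ (letterCount-replicate A B l) (letterCount-replicate A A l))
letterCount-segWord B l false = trans (countᵇ-++ _ (replicate l B) _)
  (trans (cong₂ _+_ (letterCount-replicate B B l) (letterCount-replicate B A l)) (+-identityʳ l))

length-segWord : ∀ l o → length (segWord l o) ≡ l + l
length-segWord l true  = trans (length-++ (replicate l A)) (cong₂ _+_ (length-replicate l) (length-replicate l))
length-segWord l false = trans (length-++ (replicate l B)) (cong₂ _+_ (length-replicate l) (length-replicate l))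

map-flipL-segWord : ∀ l o → map flipL (segWord l o) ≡ segWord l (not o)
map-flipL-segWord l true  = trans (map-++ flipL (replicate l A) _) (cong₂ _++_ (map-replicate flipL l A) (map-replicate flipL l B))
map-flipL-segWord l false = trans (map-++ flipL (replicate l B) _) (cong₂ _++_ (map-replicate flipL l B) (map-replicate flipL l A))

-- A prefix holding more than l copies of Z cannot end inside the first segment,
-- so it contains the whole segment and with it l copies of the other letter.
prefix-beyond-segWord : ∀ (p s R : List Letter) l o Z → p ++ s ≡ segWord l o ++ R →
                        l < letterCount Z p → l ≤ letterCount (flipL Z) p
prefix-beyond-segWord p s R l o Z eq l<#Z with prefix-comparable p s (segWord l o) R eq
... | inj₁ (s′ , p++s′≡seg) = ⊥-elim (<⇒≱ l<#Z (begin
      letterCount Z p                    ≤⟨ m≤m+n _ _ ⟩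
      letterCount Z p + letterCount Z s′ ≡⟨ sym (countᵇ-++ _ p s′) ⟩
      letterCount Z (p ++ s′)            ≡⟨ cong (letterCount Z) p++s′≡seg ⟩
      letterCount Z (segWord l o)        ≡⟨ letterCount-segWord Z l o ⟩
      l                                  ∎))
  where open ≤-Reasoning
... | inj₂ (p′ , refl) = begin
      l                                                          ≡⟨ sym (letterCount-segWord (flipL Z) l o) ⟩
      letterCount (flipL Z) (segWord l o)                        ≤⟨ m≤m+n _ _ ⟩
      letterCount (flipL Z) (segWord l o) + letterCount (flipL Z) p′ ≡⟨ sym (countᵇ-++ _ (segWord l o) p′) ⟩
      letterCount (flipL Z) (segWord l o ++ p′)                  ∎
  where open ≤-Reasoning

pairLetter : ∀ {k} → Fin k → Fin k → Fin k → Maybe Letter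
pairLetter a b x = if does (x Fin.≟ a) then just A else if does (x Fin.≟ b) then just B else nothing

project : ∀ {k} → Fin k → Fin k → List (Fin k) → List Letter
project a b = mapMaybe (pairLetter a b)

letterCount-A-project : ∀ {k} (a b : Fin k) w → letterCount A (project a b w) ≡ occurrences a w
letterCount-A-project a b []      = refl
letterCount-A-project a b (x ∷ w) with x Fin.≟ a
... | yes refl = cong suc (letterCount-A-project a b w)
... | no _ with x Fin.≟ b
...   | yes refl = letterCount-A-project a b w
...   | no _     = letterCount-A-project a b w

letterCount-B-project : ∀ {k} (a b : Fin k) → a ≢ b → ∀ w → letterCount B (project a b w) ≡ occurrences b w
letterCount-B-project a b a≢b []      = refl
letterCount-B-project a b a≢b (x ∷ w) with x Fin.≟ a | x Fin.≟ b
... | yes refl | yes refl = ⊥-elim (a≢b refl)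
... | yes refl | no _     = letterCount-B-project a b a≢b w
... | no _     | yes refl = cong suc (letterCount-B-project a b a≢b w)
... | no _     | no _     = letterCount-B-project a b a≢b w

length-project : ∀ {k} (a b : Fin k) → a ≢ b → ∀ w → length (project a b w) ≡ occurrences a w + occurrences b w
length-project a b a≢b []      = refl
length-project a b a≢b (x ∷ w) with x Fin.≟ a | x Fin.≟ b
... | yes refl | yes refl = ⊥-elim (a≢b refl)
... | yes refl | no _     = cong suc (length-project a b a≢b w)
... | no _     | yes refl = trans (cong suc (length-project a b a≢b w)) (sym (+-suc _ _))
... | no _     | no _     = length-project a b a≢b w

project-swap : ∀ {k} (a b : Fin k) → a ≢ b → ∀ w → project b a w ≡ map flipL (project a b w)
project-swap a b a≢b []      = refl
project-swap a b a≢b (x ∷ w) with x Fin.≟ a | x Fin.≟ b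
... | yes refl | yes refl = ⊥-elim (a≢b refl)
... | yes refl | no _     = cong (B ∷_) (project-swap a b a≢b w)
... | no _     | yes refl = cong (A ∷_) (project-swap a b a≢b w)
... | no _     | no _     = project-swap a b a≢b w

segments : ∀ {s} → (Fin s → ℕ) → (Fin s → Bool) → Bool → List Letter
segments μ o d = concatF (λ i → segWord (μ i) (o i xor d))

map-flipL-segments : ∀ {s} (μ : Fin s → ℕ) o d → map flipL (segments μ o d) ≡ segments μ o (not d)
map-flipL-segments μ o d = trans (map-concatF flipL (λ i → segWord (μ i) (o i xor d))) (concatF-cong λ i →
  trans (map-flipL-segWord (μ i) (o i xor d)) (cong (segWord (μ i)) (not-distribʳ-xor (o i) d)))

PairwiseSegments : ∀ {k s} → (Fin s → ℕ) → (Fin s → Bool) → (Fin s → List (Fin k)) → Set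
PairwiseSegments {k} μ o w = ∀ (a b : Fin k) → a ≢ b → Σ Bool λ d → project a b (concatF w) ≡ segments μ o d

-- A label occurring more than μ₀ times in w₀ forces, by pigeonhole, a label b occurring
-- fewer times, and then the projection onto the two cannot begin with segWord μ₀.
occurrences-chunk : ∀ {k s} (μ : Fin s → ℕ) (o : Fin s → Bool) (w : Fin s → List (Fin k)) →
                    (∀ i → length (w i) ≡ k * μ i) → PairwiseSegments μ o w → ∀ i c → occurrences c (w i) ≡ μ i
occurrences-chunk {k} {suc s} μ o w len segs = λ where
    zero    → occurrences-first
    (suc i) → occurrences-chunk (μ ∘ suc) (o ∘ suc) (w ∘ suc) (len ∘ suc) segs-rest i
  where
  rest : List (Fin k)
  rest = concatF (w ∘ suc)

  project-split : ∀ a b → project a b (concatF w) ≡ project a b (w zero) ++ project a b rest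
  project-split a b = mapMaybe-++ (pairLetter a b) (w zero) rest

  Σoccurrences : sumF (λ c → occurrences c (w zero)) ≡ k * μ zero
  Σoccurrences = trans (sumF-occurrences (w zero)) (len zero)

  occurrences-≤ : ∀ c → occurrences c (w zero) ≤ μ zero
  occurrences-≤ c with μ zero <? occurrences c (w zero)
  ... | no μ≮ = ≮⇒≥ μ≮
  ... | yes μ<occ with pigeonhole (λ c → occurrences c (w zero)) (μ zero) (≤-reflexive Σoccurrences) c μ<occ
  ...   | b , b≢c , occb<μ with segs c b (b≢c ∘ sym)
  ...     | d , eq = ⊥-elim (<⇒≱ occb<μ (begin
            μ zero                                ≤⟨ prefix-beyond-segWord (project c b (w zero)) (project c b rest) _ (μ zero) (o zero xor d) A
                                                       (trans (sym (project-split c b)) eq)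
                                                       (≤-trans μ<occ (≤-reflexive (sym (letterCount-A-project c b (w zero))))) ⟩
            letterCount B (project c b (w zero))  ≡⟨ letterCount-B-project c b (b≢c ∘ sym) (w zero) ⟩
            occurrences b (w zero)                ∎))
    where open ≤-Reasoning

  occurrences-first : ∀ c → occurrences c (w zero) ≡ μ zero
  occurrences-first = sumF-≤-≡⇒≡ _ (λ _ → μ zero) occurrences-≤ (trans Σoccurrences (sym (sumF-const k (μ zero))))

  segs-rest : PairwiseSegments (μ ∘ suc) (o ∘ suc) (w ∘ suc)
  segs-rest a b a≢b with segs a b a≢b
  ... | d , eq = d , proj₂ (++-cancel-length _ _ _ _ (trans (sym (project-split a b)) eq)
      (trans (length-project a b a≢b (w zero))
        (trans (cong₂ _+_ (occurrences-first a) (occurrences-first b)) (sym (length-segWord (μ zero) (o zero xor d))))))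

project-chunks : ∀ {k s} (μ : Fin s → ℕ) (o : Fin s → Bool) (w : Fin s → List (Fin k)) →
                 (∀ i → length (w i) ≡ k * μ i) → PairwiseSegments μ o w → ∀ a b → a ≢ b →
                 Σ Bool λ d → ∀ i → project a b (w i) ≡ segWord (μ i) (o i xor d)
project-chunks μ o w len segs a b a≢b with segs a b a≢b
... | d , eq = d , concatF-injective (project a b ∘ w) (λ i → segWord (μ i) (o i xor d))
      (trans (sym (mapMaybe-concatF (pairLetter a b) w)) eq)
      (λ i → trans (length-project a b a≢b (w i))
        (trans (cong₂ _+_ (occurrences-chunk μ o w len segs i a) (occurrences-chunk μ o w len segs i b))
          (sym (length-segWord (μ i) (o i xor d)))))

-- membership at a natural-number position (false beyond n)
lookupℕ : ∀ {n} → Subset n → ℕ → Bool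
lookupℕ []      p       = false
lookupℕ (x ∷ e) zero    = x
lookupℕ (x ∷ e) (suc p) = lookupℕ e p

lookupℕ-toℕ : ∀ {n} (e : Subset n) v → lookupℕ e (toℕ v) ≡ lookup e v
lookupℕ-toℕ (x ∷ e) zero    = refl
lookupℕ-toℕ (x ∷ e) (suc v) = lookupℕ-toℕ e v

lookupℕ⇒∈ : ∀ {n} (e : Subset n) p → lookupℕ e p ≡ true → Σ (Fin n) λ v → toℕ v ≡ p × v ∈ e
lookupℕ⇒∈ (true ∷ e) zero    _ = zero , refl , here
lookupℕ⇒∈ (x ∷ e)    (suc p) h with lookupℕ⇒∈ e p h
... | v , refl , v∈e = suc v , refl , there v∈e

lookupℕ-∪ : ∀ {n} (e f : Subset n) p → lookupℕ (e ∪ f) p ≡ lookupℕ e p ∨ lookupℕ f p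
lookupℕ-∪ []      []      p       = refl
lookupℕ-∪ (x ∷ e) (y ∷ f) zero    = refl
lookupℕ-∪ (x ∷ e) (y ∷ f) (suc p) = lookupℕ-∪ e f p

lookupℕ-⊥ : ∀ n p → lookupℕ (Sub.⊥ {n}) p ≡ false
lookupℕ-⊥ zero    p       = refl
lookupℕ-⊥ (suc n) zero    = refl
lookupℕ-⊥ (suc n) (suc p) = lookupℕ-⊥ n p

lookupℕ-disjoint : ∀ {n} (e f : Subset n) → Disjoint e f → ∀ p → lookupℕ e p ≡ true → lookupℕ f p ≡ true → ⊥
lookupℕ-disjoint e f e∩f≡∅ p p∈e p∈f with lookupℕ⇒∈ e p p∈e | lookupℕ⇒∈ f p p∈f
... | v , v≡p , v∈e | v′ , v′≡p , v′∈f with Finₚ.toℕ-injective (trans v≡p (sym v′≡p))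
...   | refl = e∩f≡∅ v v∈e v′∈f

∣∣-countᵇ : ∀ {n} (e : Subset n) → ∣ e ∣ ≡ countᵇ (lookupℕ e) (interval 0 n)
∣∣-countᵇ []                  = refl
∣∣-countᵇ {suc n} (true ∷ e)  = cong suc (trans (∣∣-countᵇ e) (sym (countᵇ-interval-suc _ 0 n)))
∣∣-countᵇ {suc n} (false ∷ e) = trans (∣∣-countᵇ e) (sym (countᵇ-interval-suc _ 0 n))

∣∣-sumF : ∀ {n} (e : Subset n) → ∣ e ∣ ≡ sumF (𝟙 ∘ lookup e)
∣∣-sumF []          = refl
∣∣-sumF (true ∷ e)  = cong suc (∣∣-sumF e)
∣∣-sumF (false ∷ e) = ∣∣-sumF e

anyᶠ : ∀ {m} → (Fin m → Bool) → Bool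
anyᶠ {zero}  g = false
anyᶠ {suc m} g = g zero ∨ anyᶠ (g ∘ suc)

anyᶠ-false : ∀ {m} (g : Fin m → Bool) → (∀ j → g j ≡ false) → anyᶠ g ≡ false
anyᶠ-false {zero}  g g≗false = refl
anyᶠ-false {suc m} g g≗false rewrite g≗false zero = anyᶠ-false (g ∘ suc) (g≗false ∘ suc)

anyᶠ-only : ∀ {m} (g : Fin m → Bool) j → (∀ j′ → j′ ≢ j → g j′ ≡ false) → anyᶠ g ≡ g j
anyᶠ-only {suc m} g zero    others with g zero
... | true  = refl
... | false = anyᶠ-false (g ∘ suc) (λ j → others (suc j) λ ())
anyᶠ-only {suc m} g (suc j) others rewrite others zero (λ ()) =
  anyᶠ-only (g ∘ suc) j (λ j′ j′≢j → others (suc j′) (j′≢j ∘ Finₚ.suc-injective))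

anyᶠ-true : ∀ {m} (g : Fin m → Bool) j → g j ≡ true → anyᶠ g ≡ true
anyᶠ-true g zero    gj rewrite gj = refl
anyᶠ-true g (suc j) gj with g zero
... | true  = refl
... | false = anyᶠ-true (g ∘ suc) j gj

lookupℕ-⋃ : ∀ {n m} (h : Fin m → Subset n) p → lookupℕ (⋃ (map h (allFin m))) p ≡ anyᶠ (λ j → lookupℕ (h j) p)
lookupℕ-⋃ {n} h p = trans (cong (λ hs → lookupℕ (⋃ hs) p) (map-tabulate (λ j → j) h)) (⋃tabulate h)
  where
  ⋃tabulate : ∀ {m} (h : Fin m → Subset n) → lookupℕ (⋃ (List.tabulate h)) p ≡ anyᶠ (λ j → lookupℕ (h j) p)
  ⋃tabulate {zero}  h = lookupℕ-⊥ n p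
  ⋃tabulate {suc m} h = trans (lookupℕ-∪ (h zero) _ p) (cong (lookupℕ (h zero) p ∨_) (⋃tabulate (h ∘ suc)))

pairLetterAt : ∀ {n} → Subset n → Subset n → ℕ → Maybe Letter
pairLetterAt e f p = if lookupℕ e p then just A else if lookupℕ f p then just B else nothing

pairWord-mapMaybe : ∀ {n} (e f : Subset n) → pairWord e f ≡ mapMaybe (pairLetterAt e f) (interval 0 n)
pairWord-mapMaybe []          []          = refl
pairWord-mapMaybe {suc n} (true ∷ e)  (y ∷ f)     = cong (A ∷_) (trans (pairWord-mapMaybe e f) (sym (mapMaybe-interval-suc _ 0 n)))
pairWord-mapMaybe {suc n} (false ∷ e) (true ∷ f)  = cong (B ∷_) (trans (pairWord-mapMaybe e f) (sym (mapMaybe-interval-suc _ 0 n)))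
pairWord-mapMaybe {suc n} (false ∷ e) (false ∷ f) = trans (pairWord-mapMaybe e f) (sym (mapMaybe-interval-suc _ 0 n))

pairWord-swap : ∀ {n} (e f : Subset n) → Disjoint e f → pairWord f e ≡ map flipL (pairWord e f)
pairWord-swap {n} e f e∩f≡∅ = begin
  pairWord f e                                                      ≡⟨ pairWord-mapMaybe f e ⟩
  mapMaybe (pairLetterAt f e) (interval 0 n)                        ≡⟨ mapMaybe-cong swapped (interval 0 n) ⟩
  mapMaybe (Maybe.map flipL ∘ pairLetterAt e f) (interval 0 n)      ≡⟨ sym (map-mapMaybe flipL (pairLetterAt e f) (interval 0 n)) ⟩
  map flipL (mapMaybe (pairLetterAt e f) (interval 0 n))            ≡⟨ cong (map flipL) (sym (pairWord-mapMaybe e f)) ⟩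
  map flipL (pairWord e f)                                          ∎
  where
  open ≡-Reasoning
  swapped : ∀ p → pairLetterAt f e p ≡ Maybe.map flipL (pairLetterAt e f p)
  swapped p with lookupℕ e p in p∈e | lookupℕ f p in p∈f
  ... | true  | true  = ⊥-elim (lookupℕ-disjoint e f e∩f≡∅ p p∈e p∈f)
  ... | true  | false = refl
  ... | false | true  = refl
  ... | false | false = refl

firstTrue : ∀ {k} → (Fin k → Bool) → Maybe (Fin k)
firstTrue {zero}  g = nothing
firstTrue {suc k} g = if g zero then just zero else Maybe.map suc (firstTrue (g ∘ suc))

firstTrue-sound : ∀ {k} (g : Fin k → Bool) c → firstTrue g ≡ just c → g c ≡ true
firstTrue-sound {suc k} g c found with g zero in g0≡
firstTrue-sound {suc k} g zero refl | true = g0≡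
firstTrue-sound {suc k} g c found   | false with firstTrue (g ∘ suc) in found′
firstTrue-sound {suc k} g (suc c) refl | false | just c′ = firstTrue-sound (g ∘ suc) c′ found′

firstTrue-unique : ∀ {k} (g : Fin k → Bool) c → g c ≡ true → (∀ c′ → g c′ ≡ true → c′ ≡ c) → firstTrue g ≡ just c
firstTrue-unique {suc k} g c gc unique with g zero in g0≡
... | true = cong just (unique zero g0≡)
... | false with c
...   | zero   = ⊥-elim (not-¬ g0≡ gc)
...   | suc c′ = cong (Maybe.map suc)
                   (firstTrue-unique (g ∘ suc) c′ gc (λ c″ gc″ → Finₚ.suc-injective (unique (suc c″) gc″)))

firstTrue-nothing : ∀ {k} (g : Fin k → Bool) → firstTrue g ≡ nothing → ∀ c → g c ≡ false
firstTrue-nothing {suc k} g none c with g zero in g0≡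
firstTrue-nothing {suc k} g ()   c       | true
firstTrue-nothing {suc k} g none zero    | false = g0≡
firstTrue-nothing {suc k} g none (suc c) | false with firstTrue (g ∘ suc) in none′
... | nothing = firstTrue-nothing (g ∘ suc) none′ c

InPart : ∀ {s} → (Fin s → ℕ) → Fin s → ℕ → Set
InPart f i p = preSum f i ≤ p × p < preSum f i + f i

preSum-zero : ∀ {s} (f : Fin (suc s) → ℕ) → preSum f zero ≡ 0
preSum-zero {s} f = sumF-zero {suc s} _ λ _ → refl

preSum-< : ∀ {s} (f : Fin s → ℕ) i i′ → toℕ i < toℕ i′ → preSum f i + f i ≤ preSum f i′
preSum-< f zero    (suc i′) _ rewrite preSum-zero f = m≤m+n _ _
preSum-< f (suc i) (suc i′) (s≤s i<i′) =
  ≤-trans (≤-reflexive (+-assoc (f zero) _ _)) (+-monoʳ-≤ (f zero) (preSum-< (f ∘ suc) i i′ i<i′))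

preSum+≤sumF : ∀ {s} (f : Fin s → ℕ) i → preSum f i + f i ≤ sumF f
preSum+≤sumF f zero    rewrite preSum-zero f = m≤m+n _ _
preSum+≤sumF f (suc i) = ≤-trans (≤-reflexive (+-assoc (f zero) _ _)) (+-monoʳ-≤ (f zero) (preSum+≤sumF (f ∘ suc) i))

InPart-unique : ∀ {s} (f : Fin s → ℕ) i i′ p → InPart f i p → InPart f i′ p → i ≡ i′
InPart-unique f i i′ p (lo , hi) (lo′ , hi′) with <-cmp (toℕ i) (toℕ i′)
... | tri< i<i′ _ _ = ⊥-elim (<⇒≱ hi (≤-trans (preSum-< f i i′ i<i′) lo′))
... | tri≈ _ i≡i′ _ = Finₚ.toℕ-injective i≡i′
... | tri> _ _ i>i′ = ⊥-elim (<⇒≱ hi′ (≤-trans (preSum-< f i′ i i>i′) lo))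

InPart-cover : ∀ {s} (f : Fin s → ℕ) p → p < sumF f → Σ (Fin s) λ i → InPart f i p
InPart-cover {suc s} f p p<Σf with p <? f zero
... | yes p<f0 = zero , ≤-trans (≤-reflexive (preSum-zero f)) z≤n , ≤-trans p<f0 (≤-reflexive (cong (_+ f zero) (sym (preSum-zero f))))
... | no p≮f0 with InPart-cover (f ∘ suc) (p ∸ f zero) (+-cancelˡ-< (f zero) _ _ (≤-trans (≤-reflexive (cong suc p≡)) p<Σf))
  where p≡ = m+[n∸m]≡n (≮⇒≥ p≮f0)
...   | i , lo , hi = suc i , ≤-trans (+-monoʳ-≤ (f zero) lo) (≤-reflexive p≡) ,
        ≤-trans (≤-reflexive (trans (cong suc (sym p≡)) (sym (+-suc (f zero) _))))
                (≤-trans (+-monoʳ-≤ (f zero) hi) (≤-reflexive (sym (+-assoc (f zero) _ _))))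
  where p≡ = m+[n∸m]≡n (≮⇒≥ p≮f0)

interval-parts : ∀ {s} (f : Fin s → ℕ) a → interval a (sumF f) ≡ concatF (λ i → interval (a + preSum f i) (f i))
interval-parts {zero}  f a = refl
interval-parts {suc s} f a = trans (interval-+ a (f zero) _) (cong₂ _++_
  (cong (λ b → interval b (f zero)) (sym (trans (cong (a +_) (preSum-zero f)) (+-identityʳ a))))
  (trans (interval-parts (f ∘ suc) (a + f zero)) (concatF-cong λ i → cong (λ b → interval b (f (suc i))) (+-assoc a (f zero) _))))

countᵇ-cong-interval : ∀ (P Q : ℕ → Bool) a c → (∀ p → a ≤ p → p < a + c → P p ≡ Q p) →
                       countᵇ P (interval a c) ≡ countᵇ Q (interval a c)
countᵇ-cong-interval P Q a c P≗Q = cong sum (map-cong-interval a c λ p lo hi → cong 𝟙 (P≗Q p lo hi))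

countᵇ-true : ∀ {X : Set} xs → countᵇ {X} (λ _ → true) xs ≡ length xs
countᵇ-true []       = refl
countᵇ-true (x ∷ xs) = cong suc (countᵇ-true xs)

countᵇ-false : ∀ {X : Set} xs → countᵇ {X} (λ _ → false) xs ≡ 0
countᵇ-false []       = refl
countᵇ-false (x ∷ xs) = countᵇ-false xs

countᵇ-window : ∀ a c R → a + c ≤ R → countᵇ (λ q → does ((a ≤? q) ×-dec (q <? a + c))) (interval 0 R) ≡ c
countᵇ-window a c R a+c≤R = begin
  countᵇ inWindow (interval 0 R)
    ≡⟨ cong (countᵇ inWindow) split ⟩
  countᵇ inWindow (interval 0 a ++ interval a c ++ interval (a + c) r)
    ≡⟨ countᵇ-++ inWindow (interval 0 a) _ ⟩
  countᵇ inWindow (interval 0 a) + countᵇ inWindow (interval a c ++ interval (a + c) r)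
    ≡⟨ cong₂ _+_ before (trans (countᵇ-++ inWindow (interval a c) _) (cong₂ _+_ inside after)) ⟩
  0 + (c + 0)
    ≡⟨ +-identityʳ c ⟩
  c ∎
  where
  open ≡-Reasoning
  window? : ∀ q → Dec (a ≤ q × q < a + c)
  window? q = (a ≤? q) ×-dec (q <? a + c)
  inWindow : ℕ → Bool
  inWindow q = does (window? q)
  r : ℕ
  r = R ∸ (a + c)
  split : interval 0 R ≡ interval 0 a ++ interval a c ++ interval (a + c) r
  split = trans (cong (interval 0) (trans (sym (m+[n∸m]≡n a+c≤R)) (+-assoc a c r)))
                (trans (interval-+ 0 a (c + r)) (cong (interval 0 a ++_) (interval-+ a c r)))
  before : countᵇ inWindow (interval 0 a) ≡ 0
  before = trans (countᵇ-cong-interval inWindow _ 0 a λ q _ q<a → dec-false (window? q) λ (a≤q , _) → <⇒≱ q<a a≤q)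
                 (countᵇ-false (interval 0 a))
  inside : countᵇ inWindow (interval a c) ≡ c
  inside = trans (countᵇ-cong-interval inWindow _ a c λ q a≤q q<a+c → dec-true (window? q) (a≤q , q<a+c))
                 (trans (countᵇ-true (interval a c)) (length-interval a c))
  after : countᵇ inWindow (interval (a + c) r) ≡ 0
  after = trans (countᵇ-cong-interval inWindow _ (a + c) r λ q a+c≤q _ → dec-false (window? q) λ (_ , q<a+c) → <⇒≱ q<a+c a+c≤q)
                (countᵇ-false (interval (a + c) r))

sumF-toℕ-countᵇ : ∀ {R} (h : ℕ → Bool) → sumF {R} (𝟙 ∘ h ∘ toℕ) ≡ countᵇ h (interval 0 R)
sumF-toℕ-countᵇ {zero}  h = refl
sumF-toℕ-countᵇ {suc R} h = cong (𝟙 (h 0) +_) (trans (sumF-toℕ-countᵇ {R} (h ∘ suc)) (sym (countᵇ-interval-suc h 0 R)))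

module _ {X : Set} (_≟X_ : DecidableEquality X) where

  fibreSize : ∀ {n} → (Fin n → X) → X → ℕ
  fibreSize lab x = sumF (λ v → 𝟙 (does (lab v ≟X x)))

  private
    𝟙-refl : ∀ x → 𝟙 (does (x ≟X x)) ≡ 1
    𝟙-refl x with x ≟X x
    ... | yes _   = refl
    ... | no x≢x = ⊥-elim (x≢x refl)

    inhabited-fibre : ∀ {m} (lab : Fin m → X) x → 0 < fibreSize lab x → Σ (Fin m) λ w → lab w ≡ x
    inhabited-fibre {suc m} lab x pos with lab zero ≟X x
    ... | yes lab0≡x = zero , lab0≡x
    ... | no _ with inhabited-fibre (lab ∘ suc) x pos
    ...   | w , labw≡x = suc w , labw≡x

    fibre-of-head : ∀ {m} (lab : Fin (suc m) → X) → 0 < fibreSize lab (lab zero)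
    fibre-of-head lab = ≤-trans (≤-reflexive (sym (𝟙-refl (lab zero)))) (m≤m+n _ _)

  equal-fibres⇒permutation : ∀ n m (lab : Fin n → X) (lab′ : Fin m → X) → (∀ x → fibreSize lab x ≡ fibreSize lab′ x) →
                             Σ (Permutation n m) λ φ → ∀ v → lab′ (φ ⟨$⟩ʳ v) ≡ lab v
  equal-fibres⇒permutation zero    zero    lab lab′ same = Perm.id , λ ()
  equal-fibres⇒permutation zero    (suc m) lab lab′ same = ⊥-elim (<⇒≱ (fibre-of-head lab′) (≤-reflexive (sym (same (lab′ zero)))))
  equal-fibres⇒permutation (suc n) zero    lab lab′ same = ⊥-elim (<⇒≱ (fibre-of-head lab) (≤-reflexive (same (lab zero))))
  equal-fibres⇒permutation (suc n) (suc m) lab lab′ same = insert zero w ψ , preserves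
    where
    x₀ : X
    x₀ = lab zero
    w-spec : Σ (Fin (suc m)) λ w → lab′ w ≡ x₀
    w-spec = inhabited-fibre lab′ x₀ (≤-trans (fibre-of-head lab) (≤-reflexive (same x₀)))
    w : Fin (suc m)
    w = proj₁ w-spec
    -- remove v = 0 from lab and v = w from lab′
    same′ : ∀ x → fibreSize (lab ∘ suc) x ≡ fibreSize (lab′ ∘ punchIn w) x
    same′ x = +-cancelˡ-≡ (𝟙 (does (x₀ ≟X x))) _ _ (begin
      fibreSize lab x
        ≡⟨ same x ⟩
      fibreSize lab′ x
        ≡⟨ sumF-punchIn (λ v → 𝟙 (does (lab′ v ≟X x))) w ⟩
      𝟙 (does (lab′ w ≟X x)) + fibreSize (lab′ ∘ punchIn w) x
        ≡⟨ cong (λ y → 𝟙 (does (y ≟X x)) + fibreSize (lab′ ∘ punchIn w) x) (proj₂ w-spec) ⟩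
      𝟙 (does (x₀ ≟X x)) + fibreSize (lab′ ∘ punchIn w) x ∎)
      where open ≡-Reasoning
    ψ-spec : Σ (Permutation n m) λ ψ → ∀ v → lab′ (punchIn w (ψ ⟨$⟩ʳ v)) ≡ lab (suc v)
    ψ-spec = equal-fibres⇒permutation n m (lab ∘ suc) (lab′ ∘ punchIn w) same′
    ψ : Permutation n m
    ψ = proj₁ ψ-spec
    preserves : ∀ v → lab′ (insert zero w ψ ⟨$⟩ʳ v) ≡ lab v
    preserves zero    = proj₂ w-spec
    preserves (suc v) = trans (cong lab′ (insert-punchIn zero w ψ v)) (proj₂ ψ-spec v)

-- Patterns of pairs of edges

-- The word P with each mega-block P_j flipped iff d j; the cube word P_F is the case d = extF F.
classwiseWord : (D : Shape) → (Fin (suc (t D)) → Bool) → List Letter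
classwiseWord D d = concatF (λ i → segWord (len D i) (ori D i xor d (cls D i)))

classwiseWord-cong : ∀ D d d′ → (∀ j → d j ≡ d′ j) → classwiseWord D d ≡ classwiseWord D d′
classwiseWord-cong D d d′ d≗d′ = concatF-cong λ i → cong (λ b → segWord (len D i) (ori D i xor b)) (d≗d′ (cls D i))

map-flipL-classwiseWord : ∀ D d → map flipL (classwiseWord D d) ≡ classwiseWord D (not ∘ d)
map-flipL-classwiseWord D d = trans (map-concatF flipL (λ i → segWord (len D i) (ori D i xor d (cls D i)))) (concatF-cong λ i →
  trans (map-flipL-segWord (len D i) (ori D i xor d (cls D i))) (cong (segWord (len D i)) (not-distribʳ-xor (ori D i) (d (cls D i)))))

-- Up to exchanging A and B (i.e. flipping every mega-block) the mega-block P_0 is unflipped.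
classwiseWord-in-cube : ∀ D d → Σ (Fin (t D) → Bool) λ F →
                        classwiseWord D d ≡ cubeWord D F ⊎ map flipL (classwiseWord D d) ≡ cubeWord D F
classwiseWord-in-cube D d with d zero in d₀≡
... | false = d ∘ suc , inj₁ (classwiseWord-cong D d (extF (d ∘ suc)) λ where zero → d₀≡ ; (suc j) → refl)
... | true  = not ∘ d ∘ suc , inj₂ (trans (map-flipL-classwiseWord D d)
                (classwiseWord-cong D (not ∘ d) (extF (not ∘ d ∘ suc)) λ where zero → cong not d₀≡ ; (suc j) → refl))

module CliqueFamily (D : Shape) (k : ℕ) (K : Fin (suc (t D)) → Fin k → Subset (nV D k)) (valid : ValidCliques D k K) where

  n : ℕ
  n = nV D k

  inClique : Fin (suc (t D)) → Fin k → ℕ → Bool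
  inClique j c = lookupℕ (K j c)

  blockLen : Fin (s D) → ℕ
  blockLen i = k * len D i

  sumF-blockLen : sumF blockLen ≡ n
  sumF-blockLen = sumF-* k (len D)

  preSum-blockLen : ∀ i → preSum blockLen i ≡ k * preSum (len D) i
  preSum-blockLen i = trans (sumF-cong λ i′ → if-* (toℕ i′ <ᵇ toℕ i) (len D i′))
                            (sumF-* k λ i′ → if toℕ i′ <ᵇ toℕ i then len D i′ else 0)
    where
    if-* : ∀ b x → (if b then k * x else 0) ≡ k * (if b then x else 0)
    if-* true  x = refl
    if-* false x = sym (*-zeroʳ k)

  InBlock⇒InPart : ∀ i v → InBlock D k i v → InPart blockLen i (toℕ v)
  InBlock⇒InPart i v (lo , hi) =
    ≤-trans (≤-reflexive (preSum-blockLen i)) lo ,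
    ≤-trans hi (≤-reflexive (trans (*-distribˡ-+ k (preSum (len D) i) (len D i)) (cong (_+ blockLen i) (sym (preSum-blockLen i)))))

  size : ∀ j c → ∣ K j c ∣ ≡ rj D j
  size j c = proj₁ (valid j) c

  inClique⇒InPart : ∀ j c p → inClique j c p ≡ true → Σ (Fin (s D)) λ i → cls D i ≡ j × InPart blockLen i p
  inClique⇒InPart j c p p∈ with lookupℕ⇒∈ (K j c) p p∈
  ... | v , refl , v∈ with proj₁ (proj₂ (valid j)) c v v∈
  ...   | i , clsi≡j , v∈Vᵢ = i , clsi≡j , InBlock⇒InPart i v v∈Vᵢ

  inClique-otherClass : ∀ j c i p → InPart blockLen i p → cls D i ≢ j → inClique j c p ≡ false
  inClique-otherClass j c i p p∈Vᵢ clsi≢j with inClique j c p in p∈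
  ... | false = refl
  ... | true with inClique⇒InPart j c p p∈
  ...   | i′ , clsi′≡j , p∈Vᵢ′ = ⊥-elim (clsi≢j (trans (cong (cls D) (InPart-unique blockLen i i′ p p∈Vᵢ p∈Vᵢ′)) clsi′≡j))

  inClique-disjoint : ∀ j c c′ p → c ≢ c′ → inClique j c p ≡ true → inClique j c′ p ≡ true → ⊥
  inClique-disjoint j c c′ p c≢c′ = lookupℕ-disjoint (K j c) (K j c′) (proj₁ (proj₂ (proj₂ (valid j))) c c′ c≢c′) p

  inClique-class-unique : ∀ j c j′ c′ p → inClique j c p ≡ true → inClique j′ c′ p ≡ true → j ≡ j′
  inClique-class-unique j c j′ c′ p p∈ p∈′ with inClique⇒InPart j c p p∈ | inClique⇒InPart j′ c′ p p∈′
  ... | i , clsi≡j , p∈Vᵢ | i′ , clsi′≡j′ , p∈Vᵢ′ =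
    trans (sym clsi≡j) (trans (cong (cls D) (InPart-unique blockLen i i′ p p∈Vᵢ p∈Vᵢ′)) clsi′≡j′)

  edgeAt : Fin (suc (t D)) → ℕ → Maybe (Fin k)
  edgeAt j p = firstTrue (λ c → inClique j c p)

  edgeAt-inClique : ∀ j c p → inClique j c p ≡ true → edgeAt j p ≡ just c
  edgeAt-inClique j c p p∈ = firstTrue-unique (λ c → inClique j c p) c p∈ unique
    where
    unique : ∀ c′ → inClique j c′ p ≡ true → c′ ≡ c
    unique c′ p∈′ with c′ Fin.≟ c
    ... | yes c′≡c = c′≡c
    ... | no c′≢c  = ⊥-elim (inClique-disjoint j c′ c p c′≢c p∈′ p∈)

  classLen : Fin (suc (t D)) → Fin (s D) → ℕ
  classLen j i = if isIn (cls D i) j then len D i else 0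

  classLen-own : ∀ i → classLen (cls D i) i ≡ len D i
  classLen-own i with cls D i Fin.≟ cls D i
  ... | yes _         = refl
  ... | no clsi≢clsi = ⊥-elim (clsi≢clsi refl)

  blockPositions : Fin (s D) → List ℕ
  blockPositions i = interval (preSum blockLen i) (blockLen i)

  blockWord : Fin (suc (t D)) → Fin (s D) → List (Fin k)
  blockWord j i = mapMaybe (edgeAt j) (blockPositions i)

  blockWord-otherClass : ∀ j i → cls D i ≢ j → blockWord j i ≡ []
  blockWord-otherClass j i clsi≢j = trans (cong catMaybes (map-cong-interval _ _ none)) (mapMaybe-nothing (blockPositions i))
    where
    none : ∀ p → preSum blockLen i ≤ p → p < preSum blockLen i + blockLen i → edgeAt j p ≡ nothing
    none p lo hi with edgeAt j p in found
    ... | nothing = refl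
    ... | just c with trans (sym (inClique-otherClass j c i p (lo , hi) clsi≢j))
                            (firstTrue-sound (λ c → inClique j c p) c found)
    ...   | ()

  length-blockWord-≤ : ∀ j i → length (blockWord j i) ≤ k * classLen j i
  length-blockWord-≤ j i with cls D i Fin.≟ j
  ... | yes _      = ≤-trans (length-mapMaybe (edgeAt j) (blockPositions i)) (≤-reflexive (length-interval _ (blockLen i)))
  ... | no clsi≢j rewrite blockWord-otherClass j i clsi≢j = z≤n

  -- the word over Fin k recording, for every vertex of U_j in order, its edge in K_j
  classWord : Fin (suc (t D)) → List (Fin k)
  classWord j = mapMaybe (edgeAt j) (interval 0 n)

  concatF-blockWord : ∀ j → concatF (blockWord j) ≡ classWord j
  concatF-blockWord j = begin
    concatF (mapMaybe (edgeAt j) ∘ blockPositions)     ≡⟨ sym (mapMaybe-concatF (edgeAt j) blockPositions) ⟩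
    mapMaybe (edgeAt j) (concatF blockPositions)       ≡⟨ cong (mapMaybe (edgeAt j)) (sym (interval-parts blockLen 0)) ⟩
    mapMaybe (edgeAt j) (interval 0 (sumF blockLen))   ≡⟨ cong (λ m → mapMaybe (edgeAt j) (interval 0 m)) sumF-blockLen ⟩
    classWord j                                        ∎
    where open ≡-Reasoning

  occurrences-mapMaybe-edgeAt : ∀ j c ps → occurrences c (mapMaybe (edgeAt j) ps) ≡ countᵇ (inClique j c) ps
  occurrences-mapMaybe-edgeAt j c []       = refl
  occurrences-mapMaybe-edgeAt j c (p ∷ ps) with edgeAt j p in found
  ... | nothing rewrite firstTrue-nothing (λ c → inClique j c p) found c = occurrences-mapMaybe-edgeAt j c ps
  ... | just c′ with c′ Fin.≟ c
  ...   | yes refl rewrite firstTrue-sound (λ c → inClique j c p) c′ found = cong suc (occurrences-mapMaybe-edgeAt j c ps)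
  ...   | no c′≢c with inClique j c p in p∈
  ...     | true  = ⊥-elim (inClique-disjoint j c′ c p c′≢c (firstTrue-sound (λ c → inClique j c p) c′ found) p∈)
  ...     | false = occurrences-mapMaybe-edgeAt j c ps

  occurrences-classWord : ∀ j c → occurrences c (classWord j) ≡ rj D j
  occurrences-classWord j c = begin
    occurrences c (classWord j)              ≡⟨ occurrences-mapMaybe-edgeAt j c (interval 0 n) ⟩
    countᵇ (inClique j c) (interval 0 n)     ≡⟨ sym (∣∣-countᵇ (K j c)) ⟩
    ∣ K j c ∣                                ≡⟨ size j c ⟩
    rj D j                                   ∎
    where open ≡-Reasoning

  -- Counting: K_j covers k r_j positions, and block V_i offers at most k λ_i of them to it.
  length-blockWord : ∀ j i → length (blockWord j i) ≡ k * classLen j i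
  length-blockWord j = sumF-≤-≡⇒≡ (length ∘ blockWord j) (λ i → k * classLen j i) (length-blockWord-≤ j) (begin
    sumF (length ∘ blockWord j)                     ≡⟨ sym (length-concatF (blockWord j)) ⟩
    length (concatF (blockWord j))                  ≡⟨ cong length (concatF-blockWord j) ⟩
    length (classWord j)                            ≡⟨ sym (sumF-occurrences (classWord j)) ⟩
    sumF (λ c → occurrences c (classWord j))        ≡⟨ sumF-cong (occurrences-classWord j) ⟩
    sumF {k} (λ _ → rj D j)                         ≡⟨ sumF-const k (rj D j) ⟩
    k * rj D j                                      ≡⟨ sym (sumF-* k (classLen j)) ⟩
    sumF (λ i → k * classLen j i)                   ∎)
    where open ≡-Reasoning

  project-mapMaybe-edgeAt : ∀ j a b → a ≢ b → ∀ ps →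
                            project a b (mapMaybe (edgeAt j) ps) ≡ mapMaybe (pairLetterAt (K j a) (K j b)) ps
  project-mapMaybe-edgeAt j a b a≢b ps = trans (mapMaybe-mapMaybe (edgeAt j) (pairLetter a b) ps) (mapMaybe-cong letter ps)
    where
    letterOf-a : pairLetter a b a ≡ just A
    letterOf-a with a Fin.≟ a
    ... | yes _   = refl
    ... | no a≢a = ⊥-elim (a≢a refl)
    letterOf-b : pairLetter a b b ≡ just B
    letterOf-b with b Fin.≟ a | b Fin.≟ b
    ... | yes b≡a | _       = ⊥-elim (a≢b (sym b≡a))
    ... | no _    | yes _   = refl
    ... | no _    | no b≢b = ⊥-elim (b≢b refl)
    letter : ∀ p → (edgeAt j p >>= pairLetter a b) ≡ pairLetterAt (K j a) (K j b) p
    letter p with inClique j a p in p∈a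
    ... | true rewrite edgeAt-inClique j a p p∈a = letterOf-a
    ... | false with inClique j b p in p∈b
    ...   | true rewrite edgeAt-inClique j b p p∈b = letterOf-b
    ...   | false with edgeAt j p in found
    ...     | nothing = refl
    ...     | just x with x Fin.≟ a | x Fin.≟ b
    ...       | yes refl | _        = ⊥-elim (not-¬ p∈a (firstTrue-sound (λ c → inClique j c p) a found))
    ...       | no _     | yes refl = ⊥-elim (not-¬ p∈b (firstTrue-sound (λ c → inClique j c p) b found))
    ...       | no _     | no _     = refl

  project-classWord : ∀ j a b → a ≢ b → project a b (classWord j) ≡ pairWord (K j a) (K j b)
  project-classWord j a b a≢b =
    trans (project-mapMaybe-edgeAt j a b a≢b (interval 0 n)) (sym (pairWord-mapMaybe (K j a) (K j b)))

  megaWord-segments : ∀ j → megaWord D j ≡ segments (classLen j) (ori D) false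
  megaWord-segments j = concatF-cong λ i → trans (segment i) (cong (segWord (classLen j i)) (sym (xor-identityʳ (ori D i))))
    where
    segment : ∀ i → (if isIn (cls D i) j then segWord (len D i) (ori D i) else []) ≡ segWord (classLen j i) (ori D i)
    segment i with isIn (cls D i) j | ori D i
    ... | true  | _     = refl
    ... | false | true  = refl
    ... | false | false = refl

  classWord-pairwiseSegments : ∀ j → PairwiseSegments (classLen j) (ori D) (blockWord j)
  classWord-pairwiseSegments j a b a≢b rewrite concatF-blockWord j with proj₂ (proj₂ (proj₂ (valid j))) a b a≢b
  ... | inj₁ ab-forms = false , trans (project-classWord j a b a≢b) (trans ab-forms (megaWord-segments j))
  ... | inj₂ ba-forms = true , (begin
    project a b (classWord j)                               ≡⟨ project-swap b a (a≢b ∘ sym) (classWord j) ⟩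
    map flipL (project b a (classWord j))                   ≡⟨ cong (map flipL) (project-classWord j b a (a≢b ∘ sym)) ⟩
    map flipL (pairWord (K j b) (K j a))                    ≡⟨ cong (map flipL) (trans ba-forms (megaWord-segments j)) ⟩
    map flipL (segments (classLen j) (ori D) false)         ≡⟨ map-flipL-segments (classLen j) (ori D) false ⟩
    segments (classLen j) (ori D) true                      ∎)
    where open ≡-Reasoning

  project-blockWord : ∀ j a b → a ≢ b → Σ Bool λ d → ∀ i → project a b (blockWord j i) ≡ segWord (classLen j i) (ori D i xor d)
  project-blockWord j = project-chunks (classLen j) (ori D) (blockWord j) (length-blockWord j) (classWord-pairwiseSegments j)

  edge : (Fin (suc (t D)) → Fin k) → Subset n
  edge α = ⋃ (map (λ j → K j (α j)) (allFin (suc (t D))))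

  lookupℕ-edge : ∀ α i p → InPart blockLen i p → lookupℕ (edge α) p ≡ inClique (cls D i) (α (cls D i)) p
  lookupℕ-edge α i p p∈Vᵢ = trans (lookupℕ-⋃ (λ j → K j (α j)) p)
    (anyᶠ-only _ (cls D i) λ j j≢clsi → inClique-otherClass j (α j) i p p∈Vᵢ (j≢clsi ∘ sym))

  lookupℕ-edge-⊇ : ∀ α j p → inClique j (α j) p ≡ true → lookupℕ (edge α) p ≡ true
  lookupℕ-edge-⊇ α j p p∈ = trans (lookupℕ-⋃ (λ j → K j (α j)) p) (anyᶠ-true (λ j → inClique j (α j) p) j p∈)

  rj-positive : WellFormed D → ∀ j → 0 < rj D j
  rj-positive (len-positive , _ , classes-nonempty) j with classes-nonempty j
  ... | i , refl = ≤-trans (len-positive i) (≤-trans (≤-reflexive (sym (classLen-own i))) (term≤sumF (classLen (cls D i)) i))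

  disjoint-edges-differ : WellFormed D → ∀ α β → Disjoint (edge α) (edge β) → ∀ j → α j ≢ β j
  disjoint-edges-differ wf α β disjoint j αj≡βj
    with countᵇ-positive (inClique j (α j)) (interval 0 n)
           (≤-trans (rj-positive wf j) (≤-reflexive (trans (sym (size j (α j))) (∣∣-countᵇ (K j (α j))))))
  ... | p , p∈ = lookupℕ-disjoint (edge α) (edge β) disjoint p (lookupℕ-edge-⊇ α j p p∈)
                   (lookupℕ-edge-⊇ β j p (subst (λ c → inClique j c p ≡ true) αj≡βj p∈))

  -- Within each block, the two edges meet only their own K_{cls i}-parts, whose pattern is P_{cls i} up to flipping.
  pairWord-edges : ∀ α β → (∀ j → α j ≢ β j) → Σ (Fin (suc (t D)) → Bool) λ d → pairWord (edge α) (edge β) ≡ classwiseWord D d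
  pairWord-edges α β differ = d , (begin
    pairWord (edge α) (edge β)
      ≡⟨ pairWord-mapMaybe (edge α) (edge β) ⟩
    mapMaybe letter (interval 0 n)
      ≡⟨ cong (mapMaybe letter) (trans (cong (interval 0) (sym sumF-blockLen)) (interval-parts blockLen 0)) ⟩
    mapMaybe letter (concatF blockPositions)
      ≡⟨ mapMaybe-concatF letter blockPositions ⟩
    concatF (mapMaybe letter ∘ blockPositions)
      ≡⟨ concatF-cong block ⟩
    classwiseWord D d ∎)
    where
    open ≡-Reasoning
    letter : ℕ → Maybe Letter
    letter = pairLetterAt (edge α) (edge β)
    d : Fin (suc (t D)) → Bool
    d j = proj₁ (project-blockWord j (α j) (β j) (differ j))
    block : ∀ i → mapMaybe letter (blockPositions i) ≡ segWord (len D i) (ori D i xor d (cls D i))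
    block i = begin
      mapMaybe letter (blockPositions i)
        ≡⟨ cong catMaybes (map-cong-interval _ _ λ p lo hi →
             cong₂ (λ x y → if x then just A else if y then just B else nothing)
                   (lookupℕ-edge α i p (lo , hi)) (lookupℕ-edge β i p (lo , hi))) ⟩
      mapMaybe (pairLetterAt (K j (α j)) (K j (β j))) (blockPositions i)
        ≡⟨ sym (project-mapMaybe-edgeAt j (α j) (β j) (differ j) (blockPositions i)) ⟩
      project (α j) (β j) (blockWord j i)
        ≡⟨ proj₂ (project-blockWord j (α j) (β j) (differ j)) i ⟩
      segWord (classLen j i) (ori D i xor d j)
        ≡⟨ cong (λ l → segWord l (ori D i xor d j)) (classLen-own i) ⟩
      segWord (len D i) (ori D i xor d j) ∎
      where
      j : Fin (suc (t D))
      j = cls D i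

  disjoint-edges-form-cube-pattern : WellFormed D → ∀ e f → HEdge D k K e → HEdge D k K f → Disjoint e f →
                                     Σ (Fin (t D) → Bool) λ F → Forms e f (cubeWord D F)
  disjoint-edges-form-cube-pattern wf e f (α , refl) (β , refl) disjoint
    with pairWord-edges α β (disjoint-edges-differ wf α β disjoint)
  ... | d , ef≡ with classwiseWord-in-cube D d
  ...   | F , inj₁ d-cube    = F , inj₁ (trans ef≡ d-cube)
  ...   | F , inj₂ notd-cube = F , inj₂ (trans (pairWord-swap (edge α) (edge β) disjoint) (trans (cong (map flipL) ef≡) notd-cube))

  Label : Set
  Label = Fin (suc (t D)) × Fin k

  _≟Label_ : DecidableEquality Label
  _≟Label_ = Productₚ.≡-dec Fin._≟_ Fin._≟_

  -- Every vertex lies on some K_j edge: block V_i is filled by K_{cls i} (length-blockWord).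
  covered : ∀ (v : Fin n) → Σ Label λ (j , c) → inClique j c (toℕ v) ≡ true
  covered v with InPart-cover blockLen (toℕ v) (≤-trans (Finₚ.toℕ<n v) (≤-reflexive (sym sumF-blockLen)))
  ... | i , lo , hi with mapMaybe-interval-total (edgeAt (cls D i)) _ (blockLen i)
                           (trans (length-blockWord (cls D i) i) (cong (k *_) (classLen-own i))) (toℕ v) lo hi
  ...   | c , found = (cls D i , c) , firstTrue-sound (λ c → inClique (cls D i) c (toℕ v)) c found

  label : Fin n → Label
  label v = proj₁ (covered v)

  -- A vertex on the edge K_{x₀} lies on no other K_x.
  lookup-byLabel : ∀ v ((j₀ , c₀) : Label) → inClique j₀ c₀ (toℕ v) ≡ true →
                   ∀ x → does ((j₀ , c₀) ≟Label x) ≡ lookup (K (proj₁ x) (proj₂ x)) v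
  lookup-byLabel v (j₀ , c₀) v∈₀ (j , c) with (j₀ , c₀) ≟Label (j , c)
  ... | yes refl = sym (trans (sym (lookupℕ-toℕ (K j c) v)) v∈₀)
  ... | no ≢ with lookup (K j c) v in v∈
  ...   | false = refl
  ...   | true  = ⊥-elim (≢ (cong₂ _,_ j₀≡j c₀≡c))
    where
    v∈ℕ : inClique j c (toℕ v) ≡ true
    v∈ℕ = trans (lookupℕ-toℕ (K j c) v) v∈
    j₀≡j : j₀ ≡ j
    j₀≡j = inClique-class-unique j₀ c₀ j c (toℕ v) v∈₀ v∈ℕ
    c₀≡c : c₀ ≡ c
    c₀≡c with c₀ Fin.≟ c
    ... | yes c₀≡c = c₀≡c
    ... | no c₀≢c  = ⊥-elim (inClique-disjoint j c₀ c (toℕ v) c₀≢c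
                               (subst (λ j′ → inClique j′ c₀ (toℕ v) ≡ true) j₀≡j v∈₀) v∈ℕ)

  label-≟ : ∀ v x → does (label v ≟Label x) ≡ lookup (K (proj₁ x) (proj₂ x)) v
  label-≟ v = lookup-byLabel v (label v) (proj₂ (covered v))

  fibreSize-label : ∀ x → fibreSize _≟Label_ label x ≡ rj D (proj₁ x)
  fibreSize-label (j , c) = begin
    fibreSize _≟Label_ label (j , c)    ≡⟨ sumF-cong (λ v → cong 𝟙 (label-≟ v (j , c))) ⟩
    sumF (𝟙 ∘ lookup (K j c))           ≡⟨ sym (∣∣-sumF (K j c)) ⟩
    ∣ K j c ∣                           ≡⟨ size j c ⟩
    rj D j                              ∎
    where open ≡-Reasoning

-- Isomorphism with H_k((AB)^r, π′)

sumF-rj : ∀ D → sumF (rj D) ≡ rOf D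
sumF-rj D = trans (sym (sumF-swap λ i j → if isIn (cls D i) j then len D i else 0))
                  (sumF-cong λ i → sumF-indicatorʳ (cls D i) (len D i))

-- In (AB)^r with consecutive classes, class j is the window of the r_j positions after r_0 + ⋯ + r_{j-1}.
rj-ABShape : ∀ D cls′ → ConsecutiveBlocks D cls′ → ∀ j → rj (ABShape D cls′) j ≡ rj D j
rj-ABShape D cls′ consecutive j = begin
  sumF (λ p → 𝟙 (isIn (cls′ p) j))         ≡⟨ sumF-cong (cong 𝟙 ∘ class-window) ⟩
  sumF {rOf D} (𝟙 ∘ inWindow ∘ toℕ)         ≡⟨ sumF-toℕ-countᵇ {rOf D} inWindow ⟩
  countᵇ inWindow (interval 0 (rOf D))      ≡⟨ countᵇ-window (preSum (rj D) j) (rj D j) (rOf D)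
                                                 (≤-trans (preSum+≤sumF (rj D) j) (≤-reflexive (sumF-rj D))) ⟩
  rj D j                                    ∎
  where
  open ≡-Reasoning
  window? : ∀ q → Dec (InPart (rj D) j q)
  window? q = (preSum (rj D) j ≤? q) ×-dec (q <? preSum (rj D) j + rj D j)
  inWindow : ℕ → Bool
  inWindow q = does (window? q)
  class-window : ∀ p → isIn (cls′ p) j ≡ inWindow (toℕ p)
  class-window p with cls′ p Fin.≟ j
  ... | yes refl   = sym (dec-true (window? (toℕ p)) (consecutive p))
  ... | no clsp≢j = sym (dec-false (window? (toℕ p)) λ p∈j → clsp≢j (InPart-unique (rj D) (cls′ p) j (toℕ p) (consecutive p) p∈j))

-- imageSub φ is reindex (Inverse.from φ) by definition.
reindex : ∀ {n m} → (Fin m → Fin n) → Subset n → Subset m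
reindex σ e = tabulate (lookup e ∘ σ)

Subset-ext : ∀ {n} {e f : Subset n} → (∀ v → lookup e v ≡ lookup f v) → e ≡ f
Subset-ext {e = e} {f} e≗f = trans (sym (Vecₚ.tabulate∘lookup e)) (trans (Vecₚ.tabulate-cong e≗f) (Vecₚ.tabulate∘lookup f))

lookup-reindex : ∀ {n m} (σ : Fin m → Fin n) e w → lookup (reindex σ e) w ≡ lookup e (σ w)
lookup-reindex σ e = Vecₚ.lookup∘tabulate (lookup e ∘ σ)

reindex-∪ : ∀ {n m} (σ : Fin m → Fin n) e f → reindex σ (e ∪ f) ≡ reindex σ e ∪ reindex σ f
reindex-∪ σ e f = Subset-ext λ w → begin
  lookup (reindex σ (e ∪ f)) w                       ≡⟨ lookup-reindex σ (e ∪ f) w ⟩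
  lookup (e ∪ f) (σ w)                               ≡⟨ Vecₚ.lookup-zipWith _∨_ (σ w) e f ⟩
  lookup e (σ w) ∨ lookup f (σ w)                    ≡⟨ sym (cong₂ _∨_ (lookup-reindex σ e w) (lookup-reindex σ f w)) ⟩
  lookup (reindex σ e) w ∨ lookup (reindex σ f) w    ≡⟨ sym (Vecₚ.lookup-zipWith _∨_ w (reindex σ e) (reindex σ f)) ⟩
  lookup (reindex σ e ∪ reindex σ f) w               ∎
  where open ≡-Reasoning

reindex-⊥ : ∀ {n m} (σ : Fin m → Fin n) → reindex σ Sub.⊥ ≡ Sub.⊥
reindex-⊥ σ = Subset-ext λ w → trans (lookup-reindex σ Sub.⊥ w)
  (trans (Vecₚ.lookup-replicate (σ w) false) (sym (Vecₚ.lookup-replicate w false)))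

reindex-⋃ : ∀ {n m} (σ : Fin m → Fin n) es → reindex σ (⋃ es) ≡ ⋃ (map (reindex σ) es)
reindex-⋃ σ []       = reindex-⊥ σ
reindex-⋃ σ (e ∷ es) = trans (reindex-∪ σ e (⋃ es)) (cong (reindex σ e ∪_) (reindex-⋃ σ es))

reindex-product : ∀ {n m T k} (σ : Fin m → Fin n) (K : Fin T → Fin k → Subset n) (K′ : Fin T → Fin k → Subset m) →
                  (∀ j c → reindex σ (K j c) ≡ K′ j c) → ∀ (α : Fin T → Fin k) →
                  reindex σ (⋃ (map (λ j → K j (α j)) (allFin T))) ≡ ⋃ (map (λ j → K′ j (α j)) (allFin T))
reindex-product {T = T} σ K K′ σK≡K′ α = trans (reindex-⋃ σ (map (λ j → K j (α j)) (allFin T)))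
  (cong ⋃ (trans (sym (map-∘ (allFin T))) (map-cong (λ j → σK≡K′ j (α j)) (allFin T))))

reindex-inverse : ∀ {n m} (σ : Fin m → Fin n) (τ : Fin n → Fin m) → (∀ v → σ (τ v) ≡ v) → ∀ e → reindex τ (reindex σ e) ≡ e
reindex-inverse σ τ σ∘τ≗id e = Subset-ext λ v →
  trans (lookup-reindex τ (reindex σ e) v) (trans (lookup-reindex σ e (τ v)) (cong (lookup e) (σ∘τ≗id v)))

isomorphic-to-AB : ∀ D k K → ValidCliques D k K → ∀ cls′ → ConsecutiveBlocks D cls′ →
                   ∀ K′ → ValidCliques (ABShape D cls′) k K′ → Isomorphic (HEdge D k K) (HEdge (ABShape D cls′) k K′)
isomorphic-to-AB D k K valid cls′ consecutive K′ valid′ = φ , λ e → mk⇔ (forward e) (backward e)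
  where
  module H  = CliqueFamily D k K valid
  module H′ = CliqueFamily (ABShape D cls′) k K′ valid′

  same-fibres : ∀ x → fibreSize H._≟Label_ H.label x ≡ fibreSize H._≟Label_ H′.label x
  same-fibres x = trans (H.fibreSize-label x) (trans (sym (rj-ABShape D cls′ consecutive (proj₁ x))) (sym (H′.fibreSize-label x)))

  relabelling : Σ (Permutation (nV D k) (nV (ABShape D cls′) k)) λ φ → ∀ v → H′.label (φ ⟨$⟩ʳ v) ≡ H.label v
  relabelling = equal-fibres⇒permutation H._≟Label_ _ _ H.label H′.label same-fibres
  φ : Permutation (nV D k) (nV (ABShape D cls′) k)
  φ = proj₁ relabelling
  to : Fin (nV D k) → Fin (nV (ABShape D cls′) k)
  to = Inverse.to φ
  from : Fin (nV (ABShape D cls′) k) → Fin (nV D k)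
  from = Inverse.from φ

  lookup-to : ∀ j c v → lookup (K′ j c) (to v) ≡ lookup (K j c) v
  lookup-to j c v = begin
    lookup (K′ j c) (to v)                 ≡⟨ sym (H′.label-≟ (to v) (j , c)) ⟩
    does (H′.label (to v) H.≟Label (j , c)) ≡⟨ cong (λ x → does (x H.≟Label (j , c))) (proj₂ relabelling v) ⟩
    does (H.label v H.≟Label (j , c))      ≡⟨ H.label-≟ v (j , c) ⟩
    lookup (K j c) v                       ∎
    where open ≡-Reasoning

  K-to-K′ : ∀ j c → reindex from (K j c) ≡ K′ j c
  K-to-K′ j c = Subset-ext λ w → trans (lookup-reindex from (K j c) w)
    (trans (sym (lookup-to j c (from w))) (cong (lookup (K′ j c)) (Inverse.strictlyInverseˡ φ w)))

  K′-to-K : ∀ j c → reindex to (K′ j c) ≡ K j c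
  K′-to-K j c = Subset-ext λ v → trans (lookup-reindex to (K′ j c) v) (lookup-to j c v)

  forward : ∀ e → HEdge D k K e → HEdge (ABShape D cls′) k K′ (imageSub φ e)
  forward e (α , refl) = α , reindex-product from K K′ K-to-K′ α

  backward : ∀ e → HEdge (ABShape D cls′) k K′ (imageSub φ e) → HEdge D k K e
  backward e (α , φe≡) = α , trans (sym (reindex-inverse from to (Inverse.strictlyInverseʳ φ) e))
                                   (trans (cong (reindex to) φe≡) (reindex-product to K′ K K′-to-K α))

mainTheorem15 : (D : Shape) → WellFormed D → (k : ℕ) → 2 ≤ k →
    (K : Fin (suc (t D)) → Fin k → Subset (nV D k)) → ValidCliques D k K →
      ((e f : Subset (nV D k)) → HEdge D k K e → HEdge D k K f → Disjoint e f →
        Σ (Fin (t D) → Bool) (λ F → Forms e f (cubeWord D F)))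
    × ((cls' : Fin (rOf D) → Fin (suc (t D))) → ConsecutiveBlocks D cls' →
        (K' : Fin (suc (t D)) → Fin k → Subset (nV (ABShape D cls') k)) →
        ValidCliques (ABShape D cls') k K' →
        Isomorphic (HEdge D k K) (HEdge (ABShape D cls') k K'))
mainTheorem15 D wf k _ K valid =
  CliqueFamily.disjoint-edges-form-cube-pattern D k K valid wf , isomorphic-to-AB D k K valid
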